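{- Let $\mathcal F$ be an algebraic language with no nullary symbols, $\mathbf I=([m];\mathcal F)$ a finite $\mathcal F$-algebra, and $(\mathbf A_j,\chi_j)$ ($j\in J$, $J\neq\emptyset$) $\mathcal F$-algebras with surjective homomorphisms $\chi_j\colon\mathbf A_j\to\mathbf I$. Let $\mathbf C_j:=\mathfrak C(\mathbf A_j,\chi_j)$ and $D^{(i)}:=\prod_{l\in J}\chi_l^{ -1}(i)$ for $i\in[m]$. (1) The map $B\mapsto B^*:=\{((b_j^{(1)},\dots,b_j^{(m)}))_{j\in J}\in\prod_{j\in J}C_j:(b_j^{(i)})_{j\in J}\in B\cap D^{(i)}\text{ for all }i\in[m]\}$ is an order isomorphism from the set of subuniverses $B$ of the fibered product $\prod^{\downdownarrows\mathbf I}_{j\in J}\mathbf A_j$ with $B\cap D^{(i)}\neq\emptyset$ for every $i$, onto the set of nonempty subuniverses of $\prod_{j\in J}\mathbf C_j$. (2) This map preserves intersections and coordinate manipulations (permutation and duplication of coordinates, projection onto subsets of coordinates): for $R_\ell$ ($\ell\in L$), $R$ in its domain and $K\subseteq J$, $(\bigcap_\ell R_\ell)^*=\bigcap_\ell R_\ell^*$ and $(R|_K)^*=R^*|_K$, in the sense that whenever the left side is defined so is the right side and they are equal. (3) Fix elements $d^{(i)}=(d^{(i)}_j)_{j\in J}\in D^{(i)}$ ($i\in[m]$) and define $x\mapsto\tilde x$ on $\prod^{\downdownarrows\mathbf I}_{j}A_j$ by: if $x=(x_j)_j\in D^{(i)}$, then $\tilde x$ is the element of $\prod_jC_j$ whose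 $j$-th component is the column with $i$-th entry $x_j$ and $l$-th entry $d^{(l)}_j$ for $l\neq i$. If $\mathbf B$ is a subalgebra of $\prod^{\downdownarrows\mathbf I}_j\mathbf A_j$ with $d^{(i)}\in B\cap D^{(i)}$ for all $i$, and $G\subseteq B$ generates $\mathbf B$, then $\{\tilde b:b\in G\}$ generates $\mathbf B^*$.
   Context: $[m]=\{1,\dots,m\}$. The fibered product $\prod^{\downdownarrows\mathbf I}_{j\in J}\mathbf A_j$ is the subalgebra of $\prod_j\mathbf A_j$ on $\{(a_j)_j:\chi_j(a_j)=\chi_{j'}(a_{j'})\ \forall j,j'\}=\bigcup_{i\in[m]}D^{(i)}$. For $(\mathbf A,\chi)$ with $E^{(i)}=\chi^{ -1}(i)$, $\mathfrak C(\mathbf A,\chi)$ has universe $E^{(1)}\times\dots\times E^{(m)}$ (columns $\mathbf c=(c^{(1)},\dots,c^{(m)})$), an $m$-ary operation $d(\mathbf c_1,\dots,\mathbf c_m)=(c_1^{(1)},\dots,c_m^{(m)})$, and for each $k$-ary $f\in\mathcal F$ and $\mathbf i\in[m]^k$ a $k$-ary operation $\hat f_{\mathbf i}(\mathbf c_1,\dots,\mathbf c_k)$ obtained from $\mathbf c_1$ by replacing its $f^{\mathbf I}(\mathbf i)$-th entry by $f^{\mathbf A}(c_1^{(i_1)},\dots,c_k^{(i_k)})$. -}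

module Defs where

open import Level using (0ℓ)
open import Data.Nat using (ℕ; NonZero)
open import Data.Fin using (Fin; _≟_)
open import Data.Vec using (Vec; _∷_; []; map; lookup; zipWith)
open import Data.Product using (Σ; Σ-syntax; ∃; ∃-syntax; _×_; _,_; proj₁; proj₂)
open import Data.Sum using (_⊎_; inj₁; inj₂)
open import Data.Unit using (⊤)
open import Relation.Binary.PropositionalEquality using (_≡_; refl; sym; trans; cong)
open import Relation.Nullary using (yes; no)
open import Relation.Unary using (Pred; _∈_; _⊆_; _∩_)

record Signature : Set₁ where
  field
    Op    : Set
    arity : Op → ℕ
open Signature public

NoNullary : Signature → Set
NoNullary σ = (f : Op σ) → NonZero (arity σ f)

Ops : Signature → Set → Set
Ops σ X = (f : Op σ) → Vec X (arity σ f) → X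

record Algebra (σ : Signature) : Set₁ where
  constructor mkAlgebra
  field
    Carrier : Set
    ⟦_⟧     : Ops σ Carrier
open Algebra public

IsHom : ∀ {σ m} (A : Algebra σ) (I : Ops σ (Fin m)) → (Carrier A → Fin m) → Set
IsHom {σ} A I h = (f : Op σ) (as : Vec (Carrier A) (arity σ f)) →
  h (⟦ A ⟧ f as) ≡ I f (map h as)

Surjective : {X Y : Set} → (X → Y) → Set
Surjective {X} {Y} h = (y : Y) → Σ[ x ∈ X ] h x ≡ y

IsSubuniverse : ∀ {σ} (A : Algebra σ) → Pred (Carrier A) 0ℓ → Set
IsSubuniverse {σ} A B = (f : Op σ) (as : Vec (Carrier A) (arity σ f)) →
  (∀ k → lookup as k ∈ B) → ⟦ A ⟧ f as ∈ B

data Sg {σ} (A : Algebra σ) (G : Pred (Carrier A) 0ℓ) : Pred (Carrier A) 0ℓ where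
  gen : ∀ {x} → x ∈ G → x ∈ Sg A G
  app : (f : Op σ) (as : Vec (Carrier A) (arity σ f)) →
        (∀ k → lookup as k ∈ Sg A G) → ⟦ A ⟧ f as ∈ Sg A G

Π : ∀ {σ} (J : Set) → (J → Algebra σ) → Algebra σ
Π {σ} J A = mkAlgebra ((j : J) → Carrier (A j))
                      (λ f xs j → ⟦ A j ⟧ f (map (λ x → x j) xs))

-- coordinate manipulation: R|_τ = { (x_{τ k})_{k ∈ K} : x ∈ R } for τ : K → J
-- (covers permutations, duplications, and projections onto subsets)
reindex : {J K : Set} {X : J → Set} (τ : K → J) →
          Pred ((j : J) → X j) 0ℓ → Pred ((k : K) → X (τ k)) 0ℓ
reindex τ R y = Σ[ x ∈ _ ] (x ∈ R × y ≡ (λ k → x (τ k)))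

data COp (σ : Signature) (m : ℕ) : Set where
  dOp   : COp σ m
  hat : (f : Op σ) → Vec (Fin m) (arity σ f) → COp σ m

CSig : Signature → ℕ → Signature
CSig σ m = record { Op = COp σ m ; arity = ar }
  where
  ar : COp σ m → ℕ
  ar dOp = m
  ar (hat f _) = arity σ f

module Construction {σ : Signature} (nn : NoNullary σ) {m : ℕ} (I : Ops σ (Fin m))
                    (A : Algebra σ) (χ : Carrier A → Fin m) (hom : IsHom A I χ) where

  E : Fin m → Set
  E i = Σ[ a ∈ Carrier A ] χ a ≡ i

  Col : Set
  Col = (i : Fin m) → E i

  private
    first : ∀ {k} {X : Set} → NonZero k → Vec X k → X
    first _ (x ∷ _) = x

    entries : ∀ {k} → Vec Col k → Vec (Fin m) k → Vec (Carrier A) k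
    entries = zipWith (λ c i → proj₁ (c i))

    entries-χ : ∀ {k} (cs : Vec Col k) (is : Vec (Fin m) k) → map χ (entries cs is) ≡ is
    entries-χ [] [] = refl
    entries-χ (c ∷ cs) (i ∷ is) with c i
    ... | a , p rewrite p | entries-χ cs is = refl

  replace : Col → (t : Fin m) → E t → Col
  replace c t e l with l ≟ t
  ... | yes refl = e
  ... | no _ = c l

  ops : Ops (CSig σ m) Col
  ops dOp cs i = lookup cs i i
  ops (hat f is) cs =
    replace (first (nn f) cs) (I f is)
      (⟦ A ⟧ f (entries cs is) , trans (hom f (entries cs is)) (cong (I f) (entries-χ cs is)))

  ℭ : Algebra (CSig σ m)
  ℭ = mkAlgebra Col ops

module Fibered {σ : Signature} (nn : NoNullary σ) {m : ℕ} (I : Ops σ (Fin m))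
               (J : Set) (A : J → Algebra σ) (χ : (j : J) → Carrier (A j) → Fin m)
               (hom : (j : J) → IsHom (A j) I (χ j)) where

  ΠA : Algebra σ
  ΠA = Π J A

  C : J → Algebra (CSig σ m)
  C j = Construction.ℭ nn I (A j) (χ j) (hom j)

  ΠC : Algebra (CSig σ m)
  ΠC = Π J C

  Fib : Pred (Carrier ΠA) 0ℓ
  Fib x = (j j′ : J) → χ j (x j) ≡ χ j′ (x j′)

  D : Fin m → Pred (Carrier ΠA) 0ℓ
  D i x = (j : J) → χ j (x j) ≡ i

  IsFibSubuniverse : Pred (Carrier ΠA) 0ℓ → Set
  IsFibSubuniverse B = B ⊆ Fib × IsSubuniverse ΠA B

  InDomain : Pred (Carrier ΠA) 0ℓ → Set
  InDomain B = IsFibSubuniverse B × ((i : Fin m) → Σ[ x ∈ Carrier ΠA ] x ∈ B ∩ D i)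

  star : Pred (Carrier ΠA) 0ℓ → Pred (Carrier ΠC) 0ℓ
  star B y = (i : Fin m) → (λ j → proj₁ (y j i)) ∈ B ∩ D i

  tilde : (dd : Fin m → Carrier ΠA) → ((l : Fin m) → dd l ∈ D l) →
          (i : Fin m) (x : Carrier ΠA) → x ∈ D i → Carrier ΠC
  tilde dd ddD i x px j l with l ≟ i
  ... | yes refl = x j , px j
  ... | no _ = dd l j , ddD l j

  tildeImage : (dd : Fin m → Carrier ΠA) → ((l : Fin m) → dd l ∈ D l) →
               Pred (Carrier ΠA) 0ℓ → Pred (Carrier ΠC) 0ℓ
  tildeImage dd ddD G y =
    Σ[ i ∈ Fin m ] Σ[ x ∈ Carrier ΠA ] Σ[ px ∈ x ∈ D i ] (x ∈ G × y ≡ tilde dd ddD i x px)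

-- The i-th rows (b_j^(i))_j of an element of ∏ C_j range over D^(i), and an element of ∏ C_j is
-- determined by its rows. The operations of ℭ act row-wise: the i-th row of d(y_1,…,y_m) is the
-- i-th row of y_i, and the I(f)(i_1,…,i_k)-th row of hat f (i_1,…,i_k)(y_1,…,y_k) is f applied to
-- the i_l-th row of y_l, the other rows being copied from y_1. Hence star B is closed under the
-- operations whenever B is, and conversely the set of all rows of a subuniverse S is a subuniverse
-- whose star is S again: an element whose every row occurs in S is d of elements of S. This yields
-- the isomorphism, and the generation statement follows because every element of B ∩ D^(i) is the
-- i-th row of an element generated by the x̃, x ∈ G.
module Submission where

open import Defs
open import Level using (0ℓ)
open import Axiom.Extensionality.Propositional using (Extensionality)
open import Axiom.UniquenessOfIdentityProofs.WithK using (uip)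
open import Data.Nat using (ℕ; suc; NonZero)
open import Data.Fin using (Fin; zero; _≟_)
open import Data.Vec using (Vec; []; _∷_; lookup; map; zipWith; tabulate)
open import Data.Vec.Properties using (lookup-map; lookup-zipWith; lookup∘tabulate; map-∘)
open import Data.Product using (Σ-syntax; _×_; _,_; proj₁; proj₂)
open import Data.Product.Properties using (Σ-≡,≡→≡)
open import Data.Empty using (⊥-elim)
open import Relation.Nullary using (¬_; Dec; yes; no)
open import Relation.Binary.PropositionalEquality
  using (_≡_; refl; sym; trans; cong; subst; module ≡-Reasoning)
open import Relation.Unary using (Pred; _∈_; _⊆_; _≐_; Satisfiable; ⋂)

zeroFin : ∀ {n} → NonZero n → Fin n
zeroFin {suc n} _ = zero

Sg-isSubuniverse : ∀ {σ} (A : Algebra σ) (G : Pred (Carrier A) 0ℓ) → IsSubuniverse A (Sg A G)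
Sg-isSubuniverse A G = app

Sg-least : ∀ {σ} {A : Algebra σ} {G B : Pred (Carrier A) 0ℓ} →
           IsSubuniverse A B → G ⊆ B → Sg A G ⊆ B
Sg-least sB G⊆B (gen x∈G)    = G⊆B x∈G
Sg-least sB G⊆B (app f as h) = sB f as (λ k → Sg-least sB G⊆B (h k))

module ColumnOperations {σ : Signature} (nn : NoNullary σ) {m : ℕ} (I : Ops σ (Fin m))
                        (A : Algebra σ) (χ : Carrier A → Fin m) (hom : IsHom A I χ) where
  open Construction nn I A χ hom

  hat-at-target : ∀ f is (cs : Vec Col (arity σ f)) →
                  proj₁ (ops (hat f is) cs (I f is)) ≡ ⟦ A ⟧ f (zipWith (λ c i → proj₁ (c i)) cs is)
  hat-at-target f is cs with I f is ≟ I f is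
  ... | yes refl = refl
  ... | no ≢    = ⊥-elim (≢ refl)

  hat-elsewhere : ∀ f is (cs : Vec Col (arity σ f)) l → ¬ l ≡ I f is →
                  proj₁ (ops (hat f is) cs l) ≡ proj₁ (lookup cs (zeroFin (nn f)) l)
  hat-elsewhere f is cs l l≢ with l ≟ I f is
  ... | yes l≡ = ⊥-elim (l≢ l≡)
  -- first (nn f) cs only reduces once cs is a cons, which requires generalising the arity.
  ... | no _ with arity σ f | nn f | I f | cs
  ...   | suc _ | _ | _ | _ ∷ _ = refl

module Rows (ext : Extensionality 0ℓ 0ℓ) {σ : Signature} (nn : NoNullary σ) {m : ℕ}
            (I : Ops σ (Fin m)) (J : Set) (j₀ : J) (A : J → Algebra σ)
            (χ : (j : J) → Carrier (A j) → Fin m) (hom : (j : J) → IsHom (A j) I (χ j)) where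
  open Fibered nn I J A χ hom
  private
    module Col (j : J) = ColumnOperations nn I (A j) (χ j) (hom j)
    variable
      B B′ : Pred (Carrier ΠA) 0ℓ
      S S′ : Pred (Carrier ΠC) 0ℓ

  Fib⇒D : ∀ {x} → x ∈ Fib → x ∈ D (χ j₀ (x j₀))
  Fib⇒D x∈Fib j = x∈Fib j j₀

  D-disjoint : ∀ {x i i′} → x ∈ D i → x ∈ D i′ → i ≡ i′
  D-disjoint x∈Di x∈Di′ = trans (sym (x∈Di j₀)) (x∈Di′ j₀)

  row : Carrier ΠC → Fin m → Carrier ΠA
  row y i j = proj₁ (y j i)

  row∈D : ∀ y i → row y i ∈ D i
  row∈D y i j = proj₂ (y j i)

  row-injective : ∀ {y y′} → (∀ i → row y i ≡ row y′ i) → y ≡ y′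
  row-injective rows≡ = ext λ j → ext λ i → Σ-≡,≡→≡ (cong (λ x → x j) (rows≡ i) , uip _ _)

  row-dOp : ∀ ys i → row (⟦ ΠC ⟧ dOp ys) i ≡ row (lookup ys i) i
  row-dOp ys i = ext λ j → cong (λ c → proj₁ (c i)) (lookup-map i (λ y → y j) ys)

  entries-map : ∀ {n} j (ys : Vec (Carrier ΠC) n) is →
                zipWith (λ c i → proj₁ (c i)) (map (λ y → y j) ys) is
                  ≡ map (λ x → x j) (zipWith row ys is)
  entries-map j []       []       = refl
  entries-map j (y ∷ ys) (i ∷ is) = cong (proj₁ (y j i) ∷_) (entries-map j ys is)

  row-hat-at-target : ∀ f is ys → row (⟦ ΠC ⟧ (hat f is) ys) (I f is) ≡ ⟦ ΠA ⟧ f (zipWith row ys is)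
  row-hat-at-target f is ys = ext λ j →
    trans (Col.hat-at-target j f is (map (λ y → y j) ys)) (cong (⟦ A j ⟧ f) (entries-map j ys is))

  row-hat-elsewhere : ∀ f is ys l → ¬ l ≡ I f is →
                      row (⟦ ΠC ⟧ (hat f is) ys) l ≡ row (lookup ys (zeroFin (nn f))) l
  row-hat-elsewhere f is ys l l≢ = ext λ j →
    trans (Col.hat-elsewhere j f is (map (λ y → y j) ys) l l≢)
          (cong (λ c → proj₁ (c l)) (lookup-map (zeroFin (nn f)) (λ y → y j) ys))

  ∈-by-rows : IsSubuniverse ΠC S → ∀ y →
              (∀ i → Σ[ z ∈ Carrier ΠC ] (z ∈ S × row z i ≡ row y i)) → y ∈ S
  ∈-by-rows {S} sS y rows∈S = subst S (row-injective rows≡) (sS dOp zs zs∈S)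
    where
    z = λ i → proj₁ (rows∈S i)
    zs = tabulate z
    zs∈S : ∀ k → lookup zs k ∈ S
    zs∈S k = subst S (sym (lookup∘tabulate z k)) (proj₁ (proj₂ (rows∈S k)))
    rows≡ : ∀ i → row (⟦ ΠC ⟧ dOp zs) i ≡ row y i
    rows≡ i = begin
      row (⟦ ΠC ⟧ dOp zs) i  ≡⟨ row-dOp zs i ⟩
      row (lookup zs i) i    ≡⟨ cong (λ w → row w i) (lookup∘tabulate z i) ⟩
      row (z i) i            ≡⟨ proj₂ (proj₂ (rows∈S i)) ⟩
      row y i                ∎
      where open ≡-Reasoning

  star-intro : ∀ y → (∀ i → row y i ∈ B) → y ∈ star B
  star-intro y rows∈B i = rows∈B i , row∈D y i

  star-isSubuniverse : IsSubuniverse ΠA B → IsSubuniverse ΠC (star B)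
  star-isSubuniverse {B} sB dOp ys ys∈ =
    star-intro {B} (⟦ ΠC ⟧ dOp ys) λ i → subst B (sym (row-dOp ys i)) (proj₁ (ys∈ i i))
  star-isSubuniverse {B} sB (hat f is) ys ys∈ = star-intro {B} y λ l → row∈B l (l ≟ I f is)
    where
    y = ⟦ ΠC ⟧ (hat f is) ys
    target-row∈B : row y (I f is) ∈ B
    target-row∈B = subst B (sym (row-hat-at-target f is ys)) (sB f (zipWith row ys is) λ k →
                     subst B (sym (lookup-zipWith row k ys is)) (proj₁ (ys∈ k (lookup is k))))
    -- The decision is an argument: a with on l ≟ I f is would also abstract the test inside ops.
    row∈B : ∀ l → Dec (l ≡ I f is) → row y l ∈ B
    row∈B l (yes l≡) = subst (λ t → row y t ∈ B) (sym l≡) target-row∈B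
    row∈B l (no l≢)  = subst B (sym (row-hat-elsewhere f is ys l l≢)) (proj₁ (ys∈ (zeroFin (nn f)) l))

  star-satisfiable : InDomain B → Satisfiable (star B)
  star-satisfiable (_ , meets) =
    (λ j i → proj₁ (meets i) j , proj₂ (proj₂ (meets i)) j) , λ i → proj₂ (meets i)

  star-mono : B ⊆ B′ → star B ⊆ star B′
  star-mono B⊆B′ y∈ i = B⊆B′ (proj₁ (y∈ i)) , proj₂ (y∈ i)

  star-⋂ : ∀ {L} {R : L → Pred (Carrier ΠA) 0ℓ} → star (⋂ L R) ≐ ⋂ L (λ l → star (R l))
  star-⋂ = (λ y∈ l i → proj₁ (y∈ i) l , proj₂ (y∈ i)) ,
           (λ {y} y∈ i → (λ l → proj₁ (y∈ l i)) , row∈D y i)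

  module _ (dd : Fin m → Carrier ΠA) (ddD : ∀ i → dd i ∈ D i) where

    row-tilde-same : ∀ i x (px : x ∈ D i) → row (tilde dd ddD i x px) i ≡ x
    row-tilde-same i x px with i ≟ i
    ... | yes refl = refl
    ... | no ≢    = ⊥-elim (≢ refl)

    row-tilde-other : ∀ i x (px : x ∈ D i) l → ¬ l ≡ i → row (tilde dd ddD i x px) l ≡ dd l
    row-tilde-other i x px l l≢ with l ≟ i
    ... | yes l≡ = ⊥-elim (l≢ l≡)
    ... | no _   = refl

    tilde∈star : (∀ l → dd l ∈ B) →
                 ∀ {i x} (px : x ∈ D i) → x ∈ B → tilde dd ddD i x px ∈ star B
    tilde∈star {B} dd∈B {i} {x} px x∈B = star-intro {B} (tilde dd ddD i x px) λ l → row∈B l (l ≟ i)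
      where
      row∈B : ∀ l → Dec (l ≡ i) → row (tilde dd ddD i x px) l ∈ B
      row∈B l (yes refl) = subst B (sym (row-tilde-same i x px)) x∈B
      row∈B l (no l≢)    = subst B (sym (row-tilde-other i x px l l≢)) (dd∈B l)

  rowsOf : Pred (Carrier ΠC) 0ℓ → Pred (Carrier ΠA) 0ℓ
  rowsOf S x = Σ[ i ∈ Fin m ] Σ[ y ∈ Carrier ΠC ] (y ∈ S × row y i ≡ x)

  rowsOf-mono : S ⊆ S′ → rowsOf S ⊆ rowsOf S′
  rowsOf-mono S⊆S′ (i , y , y∈S , refl) = i , y , S⊆S′ y∈S , refl

  rowsOf⊆Fib : ∀ S → rowsOf S ⊆ Fib
  rowsOf⊆Fib S (i , y , _ , refl) j j′ = trans (row∈D y i j) (sym (row∈D y i j′))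

  rowsOf-isSubuniverse : IsSubuniverse ΠC S → IsSubuniverse ΠA (rowsOf S)
  rowsOf-isSubuniverse {S} sS f xs xs∈ with lift xs xs∈
    where
    lift : ∀ {n} (xs : Vec (Carrier ΠA) n) → (∀ k → lookup xs k ∈ rowsOf S) →
           Σ[ ys ∈ Vec (Carrier ΠC) n ] Σ[ is ∈ Vec (Fin m) n ]
             ((∀ k → lookup ys k ∈ S) × zipWith row ys is ≡ xs)
    lift []       _   = [] , [] , (λ ()) , refl
    lift (x ∷ xs) xs∈ with xs∈ zero | lift xs (λ k → xs∈ (Fin.suc k))
    ... | i , y , y∈S , refl | ys , is , ys∈S , refl =
      y ∷ ys , i ∷ is , (λ { zero → y∈S ; (Fin.suc k) → ys∈S k }) , refl
  ... | ys , is , ys∈S , refl =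
    I f is , ⟦ ΠC ⟧ (hat f is) ys , sS (hat f is) ys ys∈S , row-hat-at-target f is ys

  rowsOf-star⊆ : rowsOf (star B) ⊆ B
  rowsOf-star⊆ (i , y , y∈ , refl) = proj₁ (y∈ i)

  ⊆rowsOf-star : InDomain B → B ⊆ rowsOf (star B)
  ⊆rowsOf-star {B} ((B⊆Fib , _) , meets) {x} x∈B =
    i , tilde dd ddD i x px , tilde∈star dd ddD (λ l → proj₁ (proj₂ (meets l))) px x∈B ,
    row-tilde-same dd ddD i x px
    where
    dd = λ l → proj₁ (meets l)
    ddD = λ l → proj₂ (proj₂ (meets l))
    i = χ j₀ (x j₀)
    px = Fib⇒D (B⊆Fib x∈B)

  star-reflects-⊆ : InDomain B → star B ⊆ star B′ → B ⊆ B′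
  star-reflects-⊆ {B} {B′} dB sub x∈B =
    rowsOf-star⊆ {B′} (rowsOf-mono {star B} {star B′} (λ {y} → sub {y}) (⊆rowsOf-star dB x∈B))

  ⊆star-rowsOf : S ⊆ star (rowsOf S)
  ⊆star-rowsOf {S} {y} y∈S = star-intro {rowsOf S} y λ i → i , y , y∈S , refl

  star-rowsOf⊆ : IsSubuniverse ΠC S → star (rowsOf S) ⊆ S
  star-rowsOf⊆ {S} sS {y} y∈ = ∈-by-rows sS y row-in-S
    where
    row-in-S : ∀ i → Σ[ z ∈ Carrier ΠC ] (z ∈ S × row z i ≡ row y i)
    row-in-S i with proj₁ (y∈ i)
    ... | i′ , z , z∈S , z≡ with D-disjoint (row∈D z i′) (subst (_∈ D i) (sym z≡) (row∈D y i))
    ...   | refl = z , z∈S , z≡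

  star-surjective : (S : Pred (Carrier ΠC) 0ℓ) → IsSubuniverse ΠC S → Satisfiable S →
                    Σ[ B ∈ Pred (Carrier ΠA) 0ℓ ] (InDomain B × star B ≐ S)
  star-surjective S sS (s , s∈S) =
    rowsOf S ,
    ((rowsOf⊆Fib S , rowsOf-isSubuniverse sS) , λ i → row s i , (i , s , s∈S , refl) , row∈D s i) ,
    star-rowsOf⊆ sS , ⊆star-rowsOf

  Sg-tilde≐star : ∀ dd ddD {B} → IsFibSubuniverse B → (∀ i → dd i ∈ B) →
                  ∀ {G} → G ⊆ B → Sg ΠA G ≐ B → Sg ΠC (tildeImage dd ddD G) ≐ star B
  Sg-tilde≐star dd ddD {B} (B⊆Fib , sB) dd∈B {G} G⊆B (_ , B⊆SgG) =
    Sg-least (star-isSubuniverse {B} sB) tildes⊆star ,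
    λ {y} y∈ → star-rowsOf⊆ sSgT (star-mono (λ {x} → B⊆rows {x}) {y} y∈)
    where
    T = tildeImage dd ddD G
    sSgT = Sg-isSubuniverse ΠC T
    tildes⊆star : T ⊆ star B
    tildes⊆star (i , x , px , x∈G , refl) = tilde∈star dd ddD dd∈B px (G⊆B x∈G)
    G⊆rows : G ⊆ rowsOf (Sg ΠC T)
    G⊆rows {x} x∈G =
      i , tilde dd ddD i x px , gen (i , x , px , x∈G , refl) , row-tilde-same dd ddD i x px
      where
      i = χ j₀ (x j₀)
      px = Fib⇒D (B⊆Fib (G⊆B x∈G))
    B⊆rows : B ⊆ rowsOf (Sg ΠC T)
    B⊆rows x∈B = Sg-least (rowsOf-isSubuniverse sSgT) G⊆rows (B⊆SgG x∈B)

  module Reindexing (K : Set) (τ : K → J) where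
    module FK = Fibered nn I K (λ k → A (τ k)) (λ k → χ (τ k)) (λ k → hom (τ k))

    restrict : Carrier ΠA → Carrier FK.ΠA
    restrict x k = x (τ k)

    reindex-isSubuniverse : IsSubuniverse ΠA B → IsSubuniverse FK.ΠA (reindex τ B)
    reindex-isSubuniverse {B} sB f zs zs∈ with lift zs zs∈
      where
      lift : ∀ {n} (zs : Vec (Carrier FK.ΠA) n) → (∀ k → lookup zs k ∈ reindex τ B) →
             Σ[ xs ∈ Vec (Carrier ΠA) n ] ((∀ k → lookup xs k ∈ B) × map restrict xs ≡ zs)
      lift []       _   = [] , (λ ()) , refl
      lift (z ∷ zs) zs∈ with zs∈ zero | lift zs (λ k → zs∈ (Fin.suc k))
      ... | x , x∈B , refl | xs , xs∈B , refl =
        x ∷ xs , (λ { zero → x∈B ; (Fin.suc k) → xs∈B k }) , refl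
    ... | xs , xs∈B , refl =
      ⟦ ΠA ⟧ f xs , sB f xs xs∈B ,
      ext λ k → cong (⟦ A (τ k) ⟧ f) (sym (map-∘ (λ z → z k) restrict xs))

    reindex-inDomain : InDomain B → FK.InDomain (reindex τ B)
    reindex-inDomain ((B⊆Fib , sB) , meets) =
      ((λ { (x , x∈B , refl) k k′ → B⊆Fib x∈B (τ k) (τ k′) }) , reindex-isSubuniverse sB) ,
      λ i → restrict (proj₁ (meets i)) , (proj₁ (meets i) , proj₁ (proj₂ (meets i)) , refl) ,
            λ k → proj₂ (proj₂ (meets i)) (τ k)

    -- If x lies in another D^(i′), then K is empty and any element of B ∩ D^(i) serves.
    lift-row : InDomain B → ∀ (z : Carrier FK.ΠC) i → (λ k → proj₁ (z k i)) ∈ reindex τ B →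
               Σ[ u ∈ Carrier ΠA ] (u ∈ B × u ∈ D i × (∀ k → u (τ k) ≡ proj₁ (z k i)))
    lift-row ((B⊆Fib , _) , meets) z i (x , x∈B , z≡) with χ j₀ (x j₀) ≟ i
    ... | yes refl = x , x∈B , Fib⇒D (B⊆Fib x∈B) , λ k → sym (cong (λ v → v k) z≡)
    ... | no ≢ with meets i
    ...   | u , u∈B , u∈D = u , u∈B , u∈D , λ k → ⊥-elim (≢ (begin
      χ j₀ (x j₀)              ≡⟨ B⊆Fib x∈B j₀ (τ k) ⟩
      χ (τ k) (x (τ k))        ≡⟨ cong (λ v → χ (τ k) (v k)) z≡ ⟨
      χ (τ k) (proj₁ (z k i))  ≡⟨ proj₂ (z k i) ⟩
      i                        ∎))
      where open ≡-Reasoning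

    star-reindex : InDomain B → FK.star (reindex τ B) ≐ reindex τ (star B)
    star-reindex {B} dB =
      reindex-star⊆ ,
      λ { (y , y∈ , refl) i → (row y i , proj₁ (y∈ i) , refl) , λ k → proj₂ (y (τ k) i) }
      where
      reindex-star⊆ : FK.star (reindex τ B) ⊆ reindex τ (star B)
      reindex-star⊆ {z} z∈ =
        y , star-intro {B} y (λ i → proj₁ (proj₂ (u i))) ,
        ext λ k → ext λ i → Σ-≡,≡→≡ (sym (proj₂ (proj₂ (proj₂ (u i))) k) , uip _ _)
        where
        u = λ i → lift-row dB z i (proj₁ (z∈ i))
        y : Carrier ΠC
        y j i = proj₁ (u i) j , proj₁ (proj₂ (proj₂ (u i))) j

theorem3p1 :
    Extensionality 0ℓ 0ℓ →
    (σ : Signature) (nn : NoNullary σ) (m : ℕ) (I : Ops σ (Fin m))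
    (J : Set) (j₀ : J) (A : J → Algebra σ) (χ : (j : J) → Carrier (A j) → Fin m)
    (hom : (j : J) → IsHom (A j) I (χ j)) (surj : (j : J) → Surjective (χ j)) →
    let open Fibered nn I J A χ hom in
    -- (1) B ↦ B* is an order isomorphism from the domain onto the nonempty subuniverses of ∏ C_j
    ((B : Pred (Carrier ΠA) 0ℓ) → InDomain B →
        IsSubuniverse ΠC (star B) × Satisfiable (star B))
    × ((B B′ : Pred (Carrier ΠA) 0ℓ) → InDomain B → InDomain B′ →
        (B ⊆ B′ → star B ⊆ star B′) × (star B ⊆ star B′ → B ⊆ B′))
    × ((S : Pred (Carrier ΠC) 0ℓ) → IsSubuniverse ΠC S → Satisfiable S →
        Σ[ B ∈ Pred (Carrier ΠA) 0ℓ ] (InDomain B × star B ≐ S))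
    -- (2) preservation of intersections
    × ((L : Set) (R : L → Pred (Carrier ΠA) 0ℓ) → ((l : L) → InDomain (R l)) →
        InDomain (⋂ L R) → star (⋂ L R) ≐ ⋂ L (λ l → star (R l)))
    -- (2) preservation of coordinate manipulations along τ : K → J
    × ((K : Set) (τ : K → J) (R : Pred (Carrier ΠA) 0ℓ) → InDomain R →
        Fibered.InDomain nn I K (λ k → A (τ k)) (λ k → χ (τ k)) (λ k → hom (τ k)) (reindex τ R)
        × Fibered.star nn I K (λ k → A (τ k)) (λ k → χ (τ k)) (λ k → hom (τ k)) (reindex τ R)
            ≐ reindex τ (star R))
    -- (3) generators of B yield generators of B*
    × ((dd : Fin m → Carrier ΠA) (ddD : (i : Fin m) → dd i ∈ D i)
       (B : Pred (Carrier ΠA) 0ℓ) → IsFibSubuniverse B → ((i : Fin m) → dd i ∈ B) →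
       (G : Pred (Carrier ΠA) 0ℓ) → G ⊆ B → Sg ΠA G ≐ B →
       Sg ΠC (tildeImage dd ddD G) ≐ star B)
theorem3p1 ext σ nn m I J j₀ A χ hom _ =
    (λ B dB → star-isSubuniverse {B} (proj₂ (proj₁ dB)) , star-satisfiable dB)
  , (λ B B′ dB _ → star-mono {B} {B′} , star-reflects-⊆ dB)
  , star-surjective
  , (λ L R _ _ → star-⋂ {L} {R})
  , (λ K τ R dR → Reindexing.reindex-inDomain K τ dR , Reindexing.star-reindex K τ dR)
  , (λ dd ddD B fB dd∈B G G⊆B → Sg-tilde≐star dd ddD fB dd∈B G⊆B)
  where open Rows ext nn I J j₀ A χ hom
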